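{- Define functions $S_k:\mathbb{Z}_{\ge0}\to\mathbb{Q}$ for $k\ge2$ recursively, together with $\tilde J_k(n)=\sum_{q=0}^n(-1)^q\binom{ -\frac12}{q}^{2}\binom nq S_k(q)$, by $S_2(p)=1$, $S_3(p)=-2\sum_{i=0}^{p-1}\frac{1}{(2i+1)^3}\binom{ -\frac12}{i}^{ -2}$, and for $k\ge4$ $$S_k(p)=\sum_{i=0}^{p-1}\frac{ -1}{(2i+1)^2}\binom{ -\frac12}{i}^{ -2}\sum_{j=0}^i(-1)^j\binom ij\tilde J_{k-2}(j+1).$$ Then for every $k\ge2$ and $p\ge0$, $$S_{k+2}(p)=\sum_{q=1}^{p}\left(\frac{S_k(q)}{(2q)^2}-\frac{S_k(q-1)}{(2q-1)^2}\right).$$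
   Context: $\binom{ -1/2}{p}=\frac{(-1/2)(-1/2-1)\cdots(-1/2-p+1)}{p!}$ is the generalized binomial coefficient. An empty sum is $0$. -}

module Defs where

open import Data.Nat using (ℕ; zero; suc; _+_; _∸_)
open import Data.Nat.Combinatorics using (_C_)
open import Data.Integer using (+_)
open import Data.Rational using (ℚ; 0ℚ; 1ℚ; -_; _/_; 1/_; ≢-nonZero)
  renaming (_+_ to _+ℚ_; _*_ to _*ℚ_; _-_ to _-ℚ_)
open import Data.Rational.Properties using (_≟_)
open import Relation.Nullary using (yes; no)

ℕ→ℚ : ℕ → ℚ
ℕ→ℚ n = + n / 1

_^ℚ_ : ℚ → ℕ → ℚ
x ^ℚ zero  = 1ℚ
x ^ℚ suc n = (x ^ℚ n) *ℚ x

-- total multiplicative inverse (convention: inv 0 = 0; only ever applied to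
-- nonzero arguments in this file)
inv : ℚ → ℚ
inv x with x ≟ 0ℚ
... | yes _  = 0ℚ
... | no x≢0 = 1/_ x {{≢-nonZero x≢0}}

genBinom : ℚ → ℕ → ℚ
genBinom a zero    = 1ℚ
genBinom a (suc p) = genBinom a p *ℚ ((a -ℚ ℕ→ℚ p) *ℚ inv (ℕ→ℚ (suc p)))

half : ℚ
half = + 1 / 2

b : ℕ → ℚ
b p = genBinom (- half) p

sumBelow : ℕ → (ℕ → ℚ) → ℚ
sumBelow zero    f = 0ℚ
sumBelow (suc n) f = sumBelow n f +ℚ f n

odd : ℕ → ℚ
odd i = ℕ→ℚ (suc (2 Data.Nat.* i))

-- S' m = S_{m+2},  J' m = J̃_{m+2}
mutual
  S' : ℕ → ℕ → ℚ
  S' zero p = 1ℚ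
  S' (suc zero) p =
    - (ℕ→ℚ 2 *ℚ sumBelow p (λ i → inv (odd i ^ℚ 3) *ℚ inv (b i ^ℚ 2)))
  S' (suc (suc m)) p =
    sumBelow p (λ i →
      ((- 1ℚ) *ℚ inv (odd i ^ℚ 2) *ℚ inv (b i ^ℚ 2))
      *ℚ sumBelow (suc i) (λ j → ((- 1ℚ) ^ℚ j) *ℚ ℕ→ℚ (i C j) *ℚ J' m (suc j)))

  J' : ℕ → ℕ → ℚ
  J' m n = sumBelow (suc n) (λ q →
    ((- 1ℚ) ^ℚ q) *ℚ (b q ^ℚ 2) *ℚ ℕ→ℚ (n C q) *ℚ S' m q)

-- S k = S_k for k ≥ 2 (values for k < 2 are an unused convention: 0)
S : ℕ → ℕ → ℚ
S zero p = 0ℚ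
S (suc zero) p = 0ℚ
S (suc (suc m)) p = S' m p

J̃ : ℕ → ℕ → ℚ
J̃ zero n = 0ℚ
J̃ (suc zero) n = 0ℚ
J̃ (suc (suc m)) n = J' m n

-- Write bᵢ = binom(-1/2, i) and aₖ(q) = (-1)^q b_q² S_k(q), so that J̃_k is the
-- binomial transform of aₖ.  Unfolding the definition, S_{k+2}(p) is the sum over
-- i < p of  -(2i+1)⁻² bᵢ⁻² Σ_j (-1)^j C(i,j) J̃_k(j+1).  Binomial inversion and
-- Pascal's rule collapse the inner sum to (-1)^i (aₖ(i) + aₖ(i+1)), and since
-- b_{i+1}/bᵢ = -(2i+1)/(2(i+1)), the i-th summand becomes
-- S_k(i+1)/(2(i+1))² - S_k(i)/(2i+1)².
module Submission where

open import Defs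
open import Data.Nat using (ℕ; zero; suc; _+_; _*_; _∸_; _≤_; s≤s; z≤n)
open import Data.Nat.Properties using (+-comm; +-suc; n<1+n)
import Data.Nat.Coprimality as Coprime
open import Data.Nat.Combinatorics using (_C_; nCk+nC[k+1]≡[n+1]C[k+1]; k>n⇒nCk≡0)
open import Data.Integer using (+_)
import Data.Integer as ℤ
import Data.Integer.Properties as ℤ
open import Data.Rational using (ℚ; 0ℚ; 1ℚ; -_; mkℚ; ≢-nonZero)
  renaming (_+_ to _+ℚ_; _*_ to _*ℚ_; _-_ to _-ℚ_)
open import Data.Rational.Properties
  using (_≟_; toℚᵘ-injective; toℚᵘ-fromℚᵘ; toℚᵘ-homo-+; normalize-coprime; *-inverseˡ; *-zeroˡ; neg-injective)
import Data.Rational.Unnormalised as ℚᵘ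
import Data.Rational.Unnormalised.Properties as ℚᵘ
open import Data.Rational.Solver using (module +-*-Solver)
open import Data.Empty using (⊥-elim)
open import Relation.Binary.PropositionalEquality
  using (_≡_; _≢_; refl; sym; trans; cong; cong₂; module ≡-Reasoning)
open import Relation.Nullary using (yes; no)

open +-*-Solver
open ≡-Reasoning

ℕ→ℚ≡mkℚ : ∀ n → ℕ→ℚ n ≡ mkℚ (+ n) 0 (Coprime.sym (Coprime.1-coprimeTo n))
ℕ→ℚ≡mkℚ n = normalize-coprime (Coprime.sym (Coprime.1-coprimeTo n))

ℕ→ℚ-suc≢0 : ∀ n → ℕ→ℚ (suc n) ≢ 0ℚ
ℕ→ℚ-suc≢0 n eq with trans (sym (ℕ→ℚ≡mkℚ (suc n))) eq
... | ()

ℕ→ℚ-2*suc≢0 : ∀ n → ℕ→ℚ (2 * suc n) ≢ 0ℚ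
ℕ→ℚ-2*suc≢0 n = ℕ→ℚ-suc≢0 (n + suc (n + 0))

ℕ→ℚ-+ : ∀ m n → ℕ→ℚ (m + n) ≡ ℕ→ℚ m +ℚ ℕ→ℚ n
ℕ→ℚ-+ m n = toℚᵘ-injective (ℚᵘ.≃-trans (toℚᵘ-fromℚᵘ [ m + n ]) (ℚᵘ.≃-trans integral
  (ℚᵘ.≃-sym (ℚᵘ.≃-trans (toℚᵘ-homo-+ (ℕ→ℚ m) (ℕ→ℚ n))
                          (ℚᵘ.+-cong (toℚᵘ-fromℚᵘ [ m ]) (toℚᵘ-fromℚᵘ [ n ]))))))
  where
  [_] : ℕ → ℚᵘ.ℚᵘ
  [ k ] = ℚᵘ.mkℚᵘ (+ k) 0
  integral : [ m + n ] ℚᵘ.≃ ([ m ] ℚᵘ.+ [ n ])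
  integral = ℚᵘ.*≡* (begin
    + (m + n) ℤ.* ℤ.1ℤ                         ≡⟨ ℤ.*-identityʳ _ ⟩
    + m ℤ.+ + n                                 ≡⟨ sym (cong₂ ℤ._+_ (ℤ.*-identityʳ (+ m)) (ℤ.*-identityʳ (+ n))) ⟩
    + m ℤ.* ℤ.1ℤ ℤ.+ + n ℤ.* ℤ.1ℤ               ≡⟨ sym (ℤ.*-identityʳ _) ⟩
    (+ m ℤ.* ℤ.1ℤ ℤ.+ + n ℤ.* ℤ.1ℤ) ℤ.* ℤ.1ℤ    ∎)

ℕ→ℚ-2* : ∀ n → ℕ→ℚ (2 * n) ≡ ℕ→ℚ n +ℚ ℕ→ℚ n
ℕ→ℚ-2* n = begin
  ℕ→ℚ (n + (n + 0))             ≡⟨ ℕ→ℚ-+ n (n + 0) ⟩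
  ℕ→ℚ n +ℚ ℕ→ℚ (n + 0)          ≡⟨ cong (λ k → ℕ→ℚ n +ℚ ℕ→ℚ k) (+-comm n 0) ⟩
  ℕ→ℚ n +ℚ ℕ→ℚ n                ∎

odd≡ℕ→ℚ[2*suc∸1] : ∀ n → odd n ≡ ℕ→ℚ (2 * suc n ∸ 1)
odd≡ℕ→ℚ[2*suc∸1] n = cong ℕ→ℚ (sym (+-suc n (n + 0)))

odd≡1+n+n : ∀ n → odd n ≡ 1ℚ +ℚ (ℕ→ℚ n +ℚ ℕ→ℚ n)
odd≡1+n+n n = trans (ℕ→ℚ-+ 1 (2 * n)) (cong (1ℚ +ℚ_) (ℕ→ℚ-2* n))

inv-inverseˡ : ∀ x → x ≢ 0ℚ → inv x *ℚ x ≡ 1ℚ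
inv-inverseˡ x x≢0 with x ≟ 0ℚ
... | yes x≡0  = ⊥-elim (x≢0 x≡0)
... | no  x≢0′ = *-inverseˡ x {{≢-nonZero x≢0′}}

inv-inverseʳ : ∀ x → x ≢ 0ℚ → x *ℚ inv x ≡ 1ℚ
inv-inverseʳ x x≢0 = trans (solve 2 (λ x y → x :* y := y :* x) refl x (inv x)) (inv-inverseˡ x x≢0)

inv-≢0 : ∀ x → x ≢ 0ℚ → inv x ≢ 0ℚ
inv-≢0 x x≢0 inv≡0 with begin
  1ℚ         ≡⟨ sym (inv-inverseˡ x x≢0) ⟩
  inv x *ℚ x ≡⟨ cong (_*ℚ x) inv≡0 ⟩
  0ℚ *ℚ x    ≡⟨ *-zeroˡ x ⟩
  0ℚ         ∎
... | ()

inv-unique : ∀ x y → x *ℚ y ≡ 1ℚ → inv x ≡ y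
inv-unique x y xy≡1 = begin
  inv x                 ≡⟨ solve 1 (λ u → u := u :* con 1ℚ) refl (inv x) ⟩
  inv x *ℚ 1ℚ           ≡⟨ cong (inv x *ℚ_) (sym xy≡1) ⟩
  inv x *ℚ (x *ℚ y)     ≡⟨ solve 3 (λ u x y → u :* (x :* y) := (u :* x) :* y) refl (inv x) x y ⟩
  (inv x *ℚ x) *ℚ y     ≡⟨ cong (_*ℚ y) (inv-inverseˡ x x≢0) ⟩
  1ℚ *ℚ y               ≡⟨ solve 1 (λ y → con 1ℚ :* y := y) refl y ⟩
  y                     ∎
  where
  x≢0 : x ≢ 0ℚ
  x≢0 x≡0 with trans (sym xy≡1) (trans (cong (_*ℚ y) x≡0) (*-zeroˡ y))
  ... | ()

*-≢0 : ∀ {x y} → x ≢ 0ℚ → y ≢ 0ℚ → x *ℚ y ≢ 0ℚ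
*-≢0 {x} {y} x≢0 y≢0 xy≡0 = y≢0 (begin
  y                  ≡⟨ solve 1 (λ y → y := con 1ℚ :* y) refl y ⟩
  1ℚ *ℚ y            ≡⟨ cong (_*ℚ y) (sym (inv-inverseˡ x x≢0)) ⟩
  (inv x *ℚ x) *ℚ y  ≡⟨ solve 3 (λ u x y → (u :* x) :* y := u :* (x :* y)) refl (inv x) x y ⟩
  inv x *ℚ (x *ℚ y)  ≡⟨ cong (inv x *ℚ_) xy≡0 ⟩
  inv x *ℚ 0ℚ        ≡⟨ solve 1 (λ u → u :* con 0ℚ := con 0ℚ) refl (inv x) ⟩
  0ℚ                 ∎)

^ℚ-≢0 : ∀ {x} n → x ≢ 0ℚ → x ^ℚ n ≢ 0ℚ
^ℚ-≢0 zero    x≢0 ()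
^ℚ-≢0 (suc n) x≢0 = *-≢0 (^ℚ-≢0 n x≢0) x≢0

^ℚ-distribʳ-* : ∀ x y n → (x *ℚ y) ^ℚ n ≡ x ^ℚ n *ℚ y ^ℚ n
^ℚ-distribʳ-* x y zero    = refl
^ℚ-distribʳ-* x y (suc n) = trans (cong (_*ℚ (x *ℚ y)) (^ℚ-distribʳ-* x y n))
  (solve 4 (λ a b x y → (a :* b) :* (x :* y) := (a :* x) :* (b :* y)) refl (x ^ℚ n) (y ^ℚ n) x y)

1^ℚn≡1 : ∀ n → 1ℚ ^ℚ n ≡ 1ℚ
1^ℚn≡1 zero    = refl
1^ℚn≡1 (suc n) = cong (_*ℚ 1ℚ) (1^ℚn≡1 n)

inv-^ℚ : ∀ x n → x ≢ 0ℚ → inv (x ^ℚ n) ≡ inv x ^ℚ n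
inv-^ℚ x n x≢0 = inv-unique (x ^ℚ n) (inv x ^ℚ n) (begin
  x ^ℚ n *ℚ inv x ^ℚ n  ≡⟨ sym (^ℚ-distribʳ-* x (inv x) n) ⟩
  (x *ℚ inv x) ^ℚ n     ≡⟨ cong (_^ℚ n) (inv-inverseʳ x x≢0) ⟩
  1ℚ ^ℚ n               ≡⟨ 1^ℚn≡1 n ⟩
  1ℚ                    ∎)

-- b (suc i) unfolds definitionally to b i *ℚ bRatio i.
bRatio : ℕ → ℚ
bRatio i = (- half -ℚ ℕ→ℚ i) *ℚ inv (ℕ→ℚ (suc i))

inv-2*suc : ∀ n → inv (ℕ→ℚ (2 * suc n)) ≡ half *ℚ inv (ℕ→ℚ (suc n))
inv-2*suc n = inv-unique (ℕ→ℚ (2 * suc n)) (half *ℚ N) (begin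
  ℕ→ℚ (2 * suc n) *ℚ (half *ℚ N)    ≡⟨ cong (_*ℚ (half *ℚ N)) (ℕ→ℚ-2* (suc n)) ⟩
  (n₁ +ℚ n₁) *ℚ (half *ℚ N)         ≡⟨ solve 2 (λ a u → (a :+ a) :* (con half :* u) := u :* a) refl n₁ N ⟩
  N *ℚ n₁                           ≡⟨ inv-inverseˡ n₁ (ℕ→ℚ-suc≢0 n) ⟩
  1ℚ                                ∎)
  where
  n₁ = ℕ→ℚ (suc n)
  N = inv n₁

bRatio≡-odd/even : ∀ i → bRatio i ≡ - (odd i *ℚ inv (ℕ→ℚ (2 * suc i)))
bRatio≡-odd/even i = begin
  (- half -ℚ ℕ→ℚ i) *ℚ N                        ≡⟨ solve 2 (λ n u → (:- con half :- n) :* u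
                                                     := :- ((con 1ℚ :+ (n :+ n)) :* (con half :* u))) refl (ℕ→ℚ i) N ⟩
  - ((1ℚ +ℚ (ℕ→ℚ i +ℚ ℕ→ℚ i)) *ℚ (half *ℚ N))  ≡⟨ cong₂ (λ o e → - (o *ℚ e)) (sym (odd≡1+n+n i)) (sym (inv-2*suc i)) ⟩
  - (odd i *ℚ inv (ℕ→ℚ (2 * suc i)))           ∎
  where
  N = inv (ℕ→ℚ (suc i))

b≢0 : ∀ i → b i ≢ 0ℚ
b≢0 zero    ()
b≢0 (suc i) = *-≢0 (b≢0 i) bRatio≢0
  where
  bRatio≢0 : bRatio i ≢ 0ℚ
  bRatio≢0 r≡0 = *-≢0 (ℕ→ℚ-suc≢0 (2 * i)) (inv-≢0 _ (ℕ→ℚ-2*suc≢0 i))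
    (neg-injective (trans (sym (bRatio≡-odd/even i)) r≡0))

inv-odd²*bRatio² : ∀ i → inv (odd i ^ℚ 2) *ℚ bRatio i ^ℚ 2 ≡ inv (ℕ→ℚ (2 * suc i) ^ℚ 2)
inv-odd²*bRatio² i = begin
  inv (o ^ℚ 2) *ℚ bRatio i ^ℚ 2          ≡⟨ cong (λ r → inv (o ^ℚ 2) *ℚ r ^ℚ 2) (bRatio≡-odd/even i) ⟩
  inv (o ^ℚ 2) *ℚ (- (o *ℚ E)) ^ℚ 2      ≡⟨ solve 3 (λ u o e → u :* ((con 1ℚ :* (:- (o :* e))) :* (:- (o :* e)))
                                              := (u :* ((con 1ℚ :* o) :* o)) :* ((con 1ℚ :* e) :* e)) refl (inv (o ^ℚ 2)) o E ⟩
  (inv (o ^ℚ 2) *ℚ o ^ℚ 2) *ℚ E ^ℚ 2     ≡⟨ cong (_*ℚ E ^ℚ 2) (inv-inverseˡ (o ^ℚ 2) (^ℚ-≢0 2 (ℕ→ℚ-suc≢0 (2 * i)))) ⟩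
  1ℚ *ℚ E ^ℚ 2                           ≡⟨ solve 1 (λ x → con 1ℚ :* x := x) refl (E ^ℚ 2) ⟩
  E ^ℚ 2                                 ≡⟨ sym (inv-^ℚ e 2 (ℕ→ℚ-2*suc≢0 i)) ⟩
  inv (e ^ℚ 2)                           ∎
  where
  o = odd i
  e = ℕ→ℚ (2 * suc i)
  E = inv e

sumBelow-cong : ∀ n {f g : ℕ → ℚ} → (∀ i → f i ≡ g i) → sumBelow n f ≡ sumBelow n g
sumBelow-cong zero    f≗g = refl
sumBelow-cong (suc n) f≗g = cong₂ _+ℚ_ (sumBelow-cong n f≗g) (f≗g n)

sumBelow-+ : ∀ n (f g : ℕ → ℚ) → sumBelow n (λ i → f i +ℚ g i) ≡ sumBelow n f +ℚ sumBelow n g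
sumBelow-+ zero    f g = refl
sumBelow-+ (suc n) f g = trans (cong (_+ℚ (f n +ℚ g n)) (sumBelow-+ n f g))
  (solve 4 (λ a b c d → (a :+ b) :+ (c :+ d) := (a :+ c) :+ (b :+ d)) refl
    (sumBelow n f) (sumBelow n g) (f n) (g n))

sumBelow-neg : ∀ n (f : ℕ → ℚ) → sumBelow n (λ i → - f i) ≡ - sumBelow n f
sumBelow-neg zero    f = refl
sumBelow-neg (suc n) f = trans (cong (_+ℚ (- f n)) (sumBelow-neg n f))
  (solve 2 (λ a c → (:- a) :+ (:- c) := :- (a :+ c)) refl (sumBelow n f) (f n))

sumBelow-sucˡ : ∀ n (f : ℕ → ℚ) → sumBelow (suc n) f ≡ f 0 +ℚ sumBelow n (λ i → f (suc i))
sumBelow-sucˡ zero    f = solve 1 (λ a → con 0ℚ :+ a := a :+ con 0ℚ) refl (f 0)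
sumBelow-sucˡ (suc n) f = trans (cong (_+ℚ f (suc n)) (sumBelow-sucˡ n f))
  (solve 3 (λ a b c → (a :+ b) :+ c := a :+ (b :+ c)) refl (f 0) (sumBelow n (λ i → f (suc i))) (f (suc n)))

binomialTransform : (ℕ → ℚ) → ℕ → ℚ
binomialTransform a n = sumBelow (suc n) (λ q → ℕ→ℚ (n C q) *ℚ a q)

binomialTransform-cong : ∀ {a a′ : ℕ → ℚ} n → (∀ q → a q ≡ a′ q) → binomialTransform a n ≡ binomialTransform a′ n
binomialTransform-cong n a≗a′ = sumBelow-cong (suc n) (λ q → cong (ℕ→ℚ (n C q) *ℚ_) (a≗a′ q))

binomialTransform-+ : ∀ (a a′ : ℕ → ℚ) n →
  binomialTransform (λ q → a q +ℚ a′ q) n ≡ binomialTransform a n +ℚ binomialTransform a′ n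
binomialTransform-+ a a′ n = trans
  (sumBelow-cong (suc n) (λ q → solve 3 (λ c x y → c :* (x :+ y) := c :* x :+ c :* y) refl (ℕ→ℚ (n C q)) (a q) (a′ q)))
  (sumBelow-+ (suc n) _ _)

binomialTransform-neg : ∀ (a : ℕ → ℚ) n → binomialTransform (λ q → - a q) n ≡ - binomialTransform a n
binomialTransform-neg a n = trans
  (sumBelow-cong (suc n) (λ q → solve 2 (λ c x → c :* (:- x) := :- (c :* x)) refl (ℕ→ℚ (n C q)) (a q)))
  (sumBelow-neg (suc n) _)

binomialTransform-suc : ∀ (a : ℕ → ℚ) n →
  binomialTransform a (suc n) ≡ binomialTransform a n +ℚ binomialTransform (λ q → a (suc q)) n
binomialTransform-suc a n = begin
  binomialTransform a (suc n)
    ≡⟨ sumBelow-sucˡ (suc n) _ ⟩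
  a₀ +ℚ sumBelow (suc n) (λ q → ℕ→ℚ (suc n C suc q) *ℚ a (suc q))
    ≡⟨ cong (a₀ +ℚ_) (trans (sumBelow-cong (suc n) pascal) (sumBelow-+ (suc n) _ _)) ⟩
  a₀ +ℚ (T′ +ℚ R)
    ≡⟨ solve 3 (λ x t r → x :+ (t :+ r) := (x :+ r) :+ t) refl a₀ T′ R ⟩
  (a₀ +ℚ R) +ℚ T′
    ≡⟨ cong (_+ℚ T′) (sym (sumBelow-sucˡ (suc n) (λ q → ℕ→ℚ (n C q) *ℚ a q))) ⟩
  (T +ℚ ℕ→ℚ (n C suc n) *ℚ a (suc n)) +ℚ T′
    ≡⟨ cong (λ c → (T +ℚ ℕ→ℚ c *ℚ a (suc n)) +ℚ T′) (k>n⇒nCk≡0 (n<1+n n)) ⟩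
  (T +ℚ 0ℚ *ℚ a (suc n)) +ℚ T′
    ≡⟨ solve 3 (λ t x t′ → (t :+ con 0ℚ :* x) :+ t′ := t :+ t′) refl T (a (suc n)) T′ ⟩
  T +ℚ T′ ∎
  where
  T = binomialTransform a n
  T′ = binomialTransform (λ q → a (suc q)) n
  a₀ = ℕ→ℚ (n C 0) *ℚ a 0
  R = sumBelow (suc n) (λ q → ℕ→ℚ (n C suc q) *ℚ a (suc q))
  pascal : ∀ q → ℕ→ℚ (suc n C suc q) *ℚ a (suc q)
               ≡ ℕ→ℚ (n C q) *ℚ a (suc q) +ℚ ℕ→ℚ (n C suc q) *ℚ a (suc q)
  pascal q = begin
    ℕ→ℚ (suc n C suc q) *ℚ a (suc q)
      ≡⟨ cong (λ c → ℕ→ℚ c *ℚ a (suc q)) (sym (nCk+nC[k+1]≡[n+1]C[k+1] n q)) ⟩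
    ℕ→ℚ (n C q + n C suc q) *ℚ a (suc q)
      ≡⟨ cong (_*ℚ a (suc q)) (ℕ→ℚ-+ (n C q) (n C suc q)) ⟩
    (ℕ→ℚ (n C q) +ℚ ℕ→ℚ (n C suc q)) *ℚ a (suc q)
      ≡⟨ solve 3 (λ c d x → (c :+ d) :* x := c :* x :+ d :* x) refl (ℕ→ℚ (n C q)) (ℕ→ℚ (n C suc q)) (a (suc q)) ⟩
    ℕ→ℚ (n C q) *ℚ a (suc q) +ℚ ℕ→ℚ (n C suc q) *ℚ a (suc q) ∎

sign : ℕ → ℚ
sign j = (- 1ℚ) ^ℚ j

sign-square : ∀ i → sign i *ℚ sign i ≡ 1ℚ
sign-square i = trans (sym (^ℚ-distribʳ-* (- 1ℚ) (- 1ℚ) i)) (1^ℚn≡1 i)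

alternatingTransform : (ℕ → ℚ) → ℕ → ℚ
alternatingTransform f = binomialTransform (λ j → sign j *ℚ f j)

alternatingTransform-cong : ∀ {f g : ℕ → ℚ} i → (∀ j → f j ≡ g j) →
  alternatingTransform f i ≡ alternatingTransform g i
alternatingTransform-cong i f≗g = binomialTransform-cong i (λ j → cong (sign j *ℚ_) (f≗g j))

alternatingTransform-+ : ∀ (f g : ℕ → ℚ) i →
  alternatingTransform (λ j → f j +ℚ g j) i ≡ alternatingTransform f i +ℚ alternatingTransform g i
alternatingTransform-+ f g i = trans
  (binomialTransform-cong i (λ j → solve 3 (λ s x y → s :* (x :+ y) := s :* x :+ s :* y) refl (sign j) (f j) (g j)))
  (binomialTransform-+ _ _ i)

alternatingTransform-suc : ∀ (f : ℕ → ℚ) i →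
  alternatingTransform f (suc i) ≡ - alternatingTransform (λ j → f (suc j) -ℚ f j) i
alternatingTransform-suc f i = begin
  alternatingTransform f (suc i)
    ≡⟨ binomialTransform-suc _ i ⟩
  binomialTransform sf i +ℚ binomialTransform (λ j → sf (suc j)) i
    ≡⟨ sym (binomialTransform-+ _ _ i) ⟩
  binomialTransform (λ j → sf j +ℚ sf (suc j)) i
    ≡⟨ binomialTransform-cong i (λ j → solve 3 (λ s x y → s :* x :+ (s :* (:- con 1ℚ)) :* y := :- (s :* (y :- x)))
                                                 refl (sign j) (f j) (f (suc j))) ⟩
  binomialTransform (λ j → - (sign j *ℚ (f (suc j) -ℚ f j))) i
    ≡⟨ binomialTransform-neg _ i ⟩
  - alternatingTransform (λ j → f (suc j) -ℚ f j) i ∎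
  where
  sf : ℕ → ℚ
  sf j = sign j *ℚ f j

alternatingTransform-binomialTransform : ∀ (a : ℕ → ℚ) i →
  alternatingTransform (binomialTransform a) i ≡ sign i *ℚ a i
alternatingTransform-binomialTransform a zero =
  solve 1 (λ x → con 0ℚ :+ con 1ℚ :* (con 1ℚ :* (con 0ℚ :+ con 1ℚ :* x)) := con 1ℚ :* x) refl (a 0)
alternatingTransform-binomialTransform a (suc i) = begin
  alternatingTransform (binomialTransform a) (suc i)
    ≡⟨ alternatingTransform-suc _ i ⟩
  - alternatingTransform (λ j → binomialTransform a (suc j) -ℚ binomialTransform a j) i
    ≡⟨ cong -_ (alternatingTransform-cong i difference) ⟩
  - alternatingTransform (binomialTransform a′) i
    ≡⟨ cong -_ (alternatingTransform-binomialTransform a′ i) ⟩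
  - (sign i *ℚ a′ i)
    ≡⟨ solve 2 (λ s x → :- (s :* x) := (s :* (:- con 1ℚ)) :* x) refl (sign i) (a′ i) ⟩
  sign (suc i) *ℚ a (suc i) ∎
  where
  a′ : ℕ → ℚ
  a′ q = a (suc q)
  difference : ∀ j → binomialTransform a (suc j) -ℚ binomialTransform a j ≡ binomialTransform a′ j
  difference j = trans (cong (_-ℚ binomialTransform a j) (binomialTransform-suc a j))
    (solve 2 (λ x y → (x :+ y) :- x := y) refl (binomialTransform a j) (binomialTransform a′ j))

alternatingTransform-binomialTransform-suc : ∀ (a : ℕ → ℚ) i →
  alternatingTransform (λ j → binomialTransform a (suc j)) i ≡ sign i *ℚ (a i +ℚ a (suc i))
alternatingTransform-binomialTransform-suc a i = begin
  alternatingTransform (λ j → binomialTransform a (suc j)) i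
    ≡⟨ alternatingTransform-cong i (λ j → binomialTransform-suc a j) ⟩
  alternatingTransform (λ j → binomialTransform a j +ℚ binomialTransform a′ j) i
    ≡⟨ alternatingTransform-+ _ _ i ⟩
  alternatingTransform (binomialTransform a) i +ℚ alternatingTransform (binomialTransform a′) i
    ≡⟨ cong₂ _+ℚ_ (alternatingTransform-binomialTransform a i) (alternatingTransform-binomialTransform a′ i) ⟩
  sign i *ℚ a i +ℚ sign i *ℚ a′ i
    ≡⟨ solve 3 (λ s x y → s :* x :+ s :* y := s :* (x :+ y)) refl (sign i) (a i) (a′ i) ⟩
  sign i *ℚ (a i +ℚ a (suc i)) ∎
  where
  a′ : ℕ → ℚ
  a′ q = a (suc q)

weightedS : ℕ → ℕ → ℚ
weightedS m q = (sign q *ℚ b q ^ℚ 2) *ℚ S' m q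

J'≡binomialTransform : ∀ m n → J' m n ≡ binomialTransform (weightedS m) n
J'≡binomialTransform m n = sumBelow-cong (suc n) (λ q →
  solve 4 (λ s β c x → ((s :* β) :* c) :* x := c :* ((s :* β) :* x)) refl (sign q) (b q ^ℚ 2) (ℕ→ℚ (n C q)) (S' m q))

S'-summand : ∀ m i →
  ((- 1ℚ) *ℚ inv (odd i ^ℚ 2) *ℚ inv (b i ^ℚ 2))
    *ℚ sumBelow (suc i) (λ j → ((- 1ℚ) ^ℚ j) *ℚ ℕ→ℚ (i C j) *ℚ J' m (suc j))
  ≡ S' m (suc i) *ℚ inv (ℕ→ℚ (2 * suc i) ^ℚ 2) -ℚ S' m i *ℚ inv (odd i ^ℚ 2)
S'-summand m i = begin
  X *ℚ sumBelow (suc i) (λ j → sign j *ℚ ℕ→ℚ (i C j) *ℚ J' m (suc j))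
    ≡⟨ cong (X *ℚ_) (trans (sumBelow-cong (suc i) asAlternating) (alternatingTransform-binomialTransform-suc a i)) ⟩
  X *ℚ (σ *ℚ (a i +ℚ a (suc i)))
    ≡⟨ solve 7 (λ σ ib β io ρ s₀ s₁ →
          ((:- con 1ℚ :* io) :* ib) :* (σ :* ((σ :* ((con 1ℚ :* β) :* β)) :* s₀
            :+ ((σ :* (:- con 1ℚ)) :* ((con 1ℚ :* (β :* ρ)) :* (β :* ρ))) :* s₁))
          := ((σ :* σ) :* (ib :* ((con 1ℚ :* β) :* β))) :* ((io :* ((con 1ℚ :* ρ) :* ρ)) :* s₁ :- io :* s₀))
        refl σ IB (b i) IO (bRatio i) (S' m i) (S' m (suc i)) ⟩
  ((σ *ℚ σ) *ℚ (IB *ℚ b i ^ℚ 2)) *ℚ ((IO *ℚ bRatio i ^ℚ 2) *ℚ S' m (suc i) -ℚ IO *ℚ S' m i)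
    ≡⟨ cong₂ (λ u v → u *ℚ (v *ℚ S' m (suc i) -ℚ IO *ℚ S' m i))
             (cong₂ _*ℚ_ (sign-square i) (inv-inverseˡ (b i ^ℚ 2) (^ℚ-≢0 2 (b≢0 i))))
             (inv-odd²*bRatio² i) ⟩
  (1ℚ *ℚ 1ℚ) *ℚ (IE *ℚ S' m (suc i) -ℚ IO *ℚ S' m i)
    ≡⟨ solve 4 (λ ie io s₀ s₁ → (con 1ℚ :* con 1ℚ) :* (ie :* s₁ :- io :* s₀) := s₁ :* ie :- s₀ :* io)
         refl IE IO (S' m i) (S' m (suc i)) ⟩
  S' m (suc i) *ℚ IE -ℚ S' m i *ℚ IO ∎
  where
  a = weightedS m
  σ = sign i
  IO = inv (odd i ^ℚ 2)
  IB = inv (b i ^ℚ 2)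
  IE = inv (ℕ→ℚ (2 * suc i) ^ℚ 2)
  X = (- 1ℚ) *ℚ IO *ℚ IB
  asAlternating : ∀ j → sign j *ℚ ℕ→ℚ (i C j) *ℚ J' m (suc j)
                      ≡ ℕ→ℚ (i C j) *ℚ (sign j *ℚ binomialTransform a (suc j))
  asAlternating j = trans (cong (sign j *ℚ ℕ→ℚ (i C j) *ℚ_) (J'≡binomialTransform m (suc j)))
    (solve 3 (λ s c x → (s :* c) :* x := c :* (s :* x)) refl (sign j) (ℕ→ℚ (i C j)) (binomialTransform a (suc j)))

mainTheorem7 : (k p : ℕ) → 2 ≤ k →
    S (k + 2) p ≡
      sumBelow p (λ i → (S k (suc i) *ℚ inv (ℕ→ℚ (2 * suc i) ^ℚ 2))
                          -ℚ (S k i *ℚ inv (ℕ→ℚ (2 * suc i ∸ 1) ^ℚ 2)))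
mainTheorem7 (suc (suc m)) p (s≤s (s≤s z≤n)) = begin
  S' (m + 2) p        ≡⟨ cong (λ n → S' n p) (+-comm m 2) ⟩
  S' (suc (suc m)) p  ≡⟨ sumBelow-cong p (λ i → trans (S'-summand m i) (cong (summand i) (odd≡ℕ→ℚ[2*suc∸1] i))) ⟩
  sumBelow p (λ i → summand i (ℕ→ℚ (2 * suc i ∸ 1))) ∎
  where
  summand : ℕ → ℚ → ℚ
  summand i o = S' m (suc i) *ℚ inv (ℕ→ℚ (2 * suc i) ^ℚ 2) -ℚ S' m i *ℚ inv (o ^ℚ 2)
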